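{- Let $G$ be a connected graph whose maximum degree is a prime number. Then $G$ is prime.
   Context: All graphs are finite, simple and undirected, without isolated vertices. For graphs $H,K$ on the vertex set $V(G)$, $G$ is factored into $H$ and $K$ if $A=BC$, where $A,B,C$ are the adjacency matrices of $G,H,K$ with respect to one common ordering of the vertices. $G$ is prime if in every factorization of $G$ into $H$ and $K$, one of $H$, $K$ is a perfect matching (a $1$-regular spanning graph); a graph with no factorization is prime. -}

module Defs where

open import Data.Nat using (ℕ; zero; suc; _⊔_; _*_)
open import Data.Bool using (Bool; true; false)
open import Data.Fin using (Fin)
open import Data.List using (List; map; foldr; allFin)
open import Data.Nat.ListAction using (sum)
open import Data.Product using (∃; _×_)
open import Data.Sum using (_⊎_)
open import Relation.Binary.PropositionalEquality using (_≡_)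
open import Relation.Nullary using (¬_)
open import Data.Nat.Primality using (Prime)

record Graph (n : ℕ) : Set where
  field
    adj       : Fin n → Fin n → Bool
    symmetric : ∀ i j → adj i j ≡ adj j i
    loopless  : ∀ i → adj i i ≡ false
    noIsolated : ∀ i → ∃ λ j → adj i j ≡ true
open Graph public

bit : Bool → ℕ
bit true  = 1
bit false = 0

adjMat : ∀ {n} → Graph n → Fin n → Fin n → ℕ
adjMat G i j = bit (adj G i j)

_⊗_ : ∀ {n} → (Fin n → Fin n → ℕ) → (Fin n → Fin n → ℕ) → Fin n → Fin n → ℕ
_⊗_ {n} B C i j = sum (map (λ k → B i k * C k j) (allFin n))

degree : ∀ {n} → Graph n → Fin n → ℕ
degree {n} G i = sum (map (λ j → adjMat G i j) (allFin n))

maxDegree : ∀ {n} → Graph n → ℕ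
maxDegree {n} G = foldr _⊔_ 0 (map (degree G) (allFin n))

data Walk {n : ℕ} (G : Graph n) : Fin n → Fin n → Set where
  here : ∀ {i} → Walk G i i
  step : ∀ {i j k} → adj G i j ≡ true → Walk G j k → Walk G i k

Connected : ∀ {n} → Graph n → Set
Connected G = ∀ i j → Walk G i j

PerfectMatching : ∀ {n} → Graph n → Set
PerfectMatching G = ∀ i → degree G i ≡ 1

FactoredInto : ∀ {n} → Graph n → Graph n → Graph n → Set
FactoredInto G H K = ∀ i j → adjMat G i j ≡ (adjMat H ⊗ adjMat K) i j

IsPrimeGraph : ∀ {n} → Graph n → Set
IsPrimeGraph {n} G = (H K : Graph n) → FactoredInto G H K →
  PerfectMatching H ⊎ PerfectMatching K

-- If G = HK, then G = KH as well, and comparing the two factorisations shows that H-neighbours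
-- have equal K-degrees and K-neighbours equal H-degrees; hence deg_G i = deg_H i * deg_K i.
-- At a vertex v of maximum, prime degree one factor, say deg_H v, is 1, and maximality forces
-- the H-neighbour of v to have H-degree 1 too: v lies on an isolated edge of H.  This property
-- passes along H-edges and K-edges, hence along G-edges, so by connectivity H is a perfect matching.
module Submission where

open import Data.Bool using (true; false)
open import Data.Empty using (⊥-elim)
open import Data.Fin using (Fin; zero; suc; punchOut; _≟_)
open import Data.Fin.Properties using (punchIn-punchOut)
open import Data.List using (foldr; map; tabulate; allFin)
open import Data.List.Membership.Propositional using (_∈_)
open import Data.List.Membership.Propositional.Properties
  using (∈-map⁺; ∈-map⁻; ∈-allFin; foldr-selective)
open import Data.List.Properties using (map-tabulate; foldr-preservesᵒ)
import Data.List.Relation.Unary.Any as Any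
open import Data.Nat using (ℕ; zero; suc; _+_; _*_; _⊔_; _≤_; _<_; z≤n; s≤s; >-nonZero; ≢-nonZero⁻¹)
open import Data.Nat.Divisibility using (m∣m*n)
open import Data.Nat.Primality using (Prime; prime⇒irreducible; prime⇒nonZero)
open import Data.Nat.Properties hiding (_≟_)
open import Data.Product using (∃; _×_; _,_; proj₁)
import Data.Product as Product
open import Data.Sum using (_⊎_; inj₁; inj₂; [_,_]′)
import Data.Sum as Sum
open import Data.Vec.Functional using (Vector; removeAt)
open import Function using (_∘_; id)
open import Relation.Binary.PropositionalEquality
open import Relation.Nullary using (¬_; yes; no)

open import Algebra.Properties.Semiring.Sum +-*-semiring
  using (sum; sum-syntax; ∑-comm; *-distribˡ-sum; *-distribʳ-sum; sum-remove; sum-cong-≗)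
import Data.Nat.ListAction as ListAction

open import Defs

sum-tabulate : ∀ {n} (f : Vector ℕ n) → ListAction.sum (tabulate f) ≡ ∑[ i < n ] f i
sum-tabulate {zero}  f = refl
sum-tabulate {suc n} f = cong (f zero +_) (sum-tabulate (f ∘ suc))

sum-map-allFin : ∀ {n} (f : Vector ℕ n) → ListAction.sum (map f (allFin n)) ≡ ∑[ i < n ] f i
sum-map-allFin f = trans (cong ListAction.sum (map-tabulate id f)) (sum-tabulate f)

∑-mono-≤ : ∀ {n} {f g : Vector ℕ n} → (∀ i → f i ≤ g i) → ∑[ i < n ] f i ≤ ∑[ i < n ] g i
∑-mono-≤ {zero}  f≤g = z≤n
∑-mono-≤ {suc n} f≤g = +-mono-≤ (f≤g zero) (∑-mono-≤ (f≤g ∘ suc))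

term≤∑ : ∀ {n} (f : Vector ℕ n) i → f i ≤ ∑[ j < n ] f j
term≤∑ {suc n} f i = ≤-trans (m≤m+n (f i) _) (≤-reflexive (sym (sum-remove {i = i} f)))

two-terms≤∑ : ∀ {n} (f : Vector ℕ n) {i j} → i ≢ j → f i + f j ≤ ∑[ k < n ] f k
two-terms≤∑ {suc n} f {i} {j} i≢j = begin
  f i + f j                   ≡⟨ cong (λ k → f i + f k) (punchIn-punchOut i≢j) ⟨
  f i + removeAt f i j′       ≤⟨ +-monoʳ-≤ (f i) (term≤∑ (removeAt f i) j′) ⟩
  f i + sum (removeAt f i)    ≡⟨ sum-remove f ⟨
  sum f                       ∎
  where
  open ≤-Reasoning
  j′ = punchOut i≢j

∑-positive : ∀ {n} (f : Vector ℕ n) → 0 < ∑[ i < n ] f i → ∃ λ i → 0 < f i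
∑-positive {suc n} f ∑>0 with f zero in eq
... | suc _ = zero , subst (0 <_) (sym eq) (s≤s z≤n)
... | zero  with i , fᵢ>0 ← ∑-positive (f ∘ suc) ∑>0 = suc i , fᵢ>0

bit≤1 : ∀ b → bit b ≤ 1
bit≤1 true  = ≤-refl
bit≤1 false = z≤n

bit-positive : ∀ {b} → 0 < bit b → b ≡ true
bit-positive {true} _ = refl

bit*bit-positive : ∀ {x y} → 0 < bit x * bit y → x ≡ true × y ≡ true
bit*bit-positive {true} {true} _ = refl , refl

bit≤bit*bit : ∀ {x y} → (x ≡ true → y ≡ true) → bit x ≤ bit x * bit y
bit≤bit*bit {false} x⇒y = z≤n
bit≤bit*bit {true}  x⇒y rewrite x⇒y refl = ≤-refl

bit*-cong : ∀ {x} {m n} → (x ≡ true → m ≡ n) → bit x * m ≡ bit x * n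
bit*-cong {false} _   = refl
bit*-cong {true}  m≡n = cong (1 *_) (m≡n refl)

m*bit≤m : ∀ m b → m * bit b ≤ m
m*bit≤m m b = ≤-trans (*-monoʳ-≤ m (bit≤1 b)) (≤-reflexive (*-identityʳ m))

prime[m*n]⇒m≡1⊎n≡1 : ∀ {m n} → Prime (m * n) → m ≡ 1 ⊎ n ≡ 1
prime[m*n]⇒m≡1⊎n≡1 {m} {n} mn-prime with prime⇒irreducible mn-prime (m∣m*n n)
... | inj₁ m≡1  = inj₁ m≡1
... | inj₂ m≡mn = inj₂ (sym (*-cancelˡ-≡ 1 n m {{m≢0}} (trans (*-identityʳ m) m≡mn)))
  where m≢0 = m*n≢0⇒m≢0 m {{prime⇒nonZero mn-prime}}

foldr-⊔-upperBound : ∀ {x} xs → x ∈ xs → x ≤ foldr _⊔_ 0 xs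
foldr-⊔-upperBound xs x∈xs = foldr-preservesᵒ upper 0 xs (inj₂ (Any.map ≤-reflexive x∈xs))
  where
  upper : ∀ {x} a b → x ≤ a ⊎ x ≤ b → x ≤ a ⊔ b
  upper a b = [ (λ x≤a → ≤-trans x≤a (m≤m⊔n a b)) , (λ x≤b → ≤-trans x≤b (m≤n⊔m a b)) ]′

module _ {n} (G : Graph n) where

  degree-as-∑ : ∀ i → degree G i ≡ ∑[ j < n ] adjMat G i j
  degree-as-∑ i = sum-map-allFin (adjMat G i)

  degree-positive : ∀ i → 0 < degree G i
  degree-positive i with j , e ← noIsolated G i =
    subst (0 <_) (sym (degree-as-∑ i)) (≤-trans (≤-reflexive (cong bit (sym e))) (term≤∑ (adjMat G i) j))

  neighbour-unique : ∀ {i k k′} → degree G i ≡ 1 → adj G i k ≡ true → adj G i k′ ≡ true → k ≡ k′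
  neighbour-unique {i} {k} {k′} dᵢ≡1 e e′ with k ≟ k′
  ... | yes k≡k′ = k≡k′
  ... | no  k≢k′ = ⊥-elim (<⇒≱ (s≤s (s≤s z≤n)) (begin
    2                               ≡⟨ cong₂ (λ x y → bit x + bit y) e e′ ⟨
    adjMat G i k + adjMat G i k′    ≤⟨ two-terms≤∑ (adjMat G i) k≢k′ ⟩
    ∑[ j < n ] adjMat G i j         ≡⟨ trans (sym (degree-as-∑ i)) dᵢ≡1 ⟩
    1                               ∎))
    where open ≤-Reasoning

  degree≤maxDegree : ∀ i → degree G i ≤ maxDegree G
  degree≤maxDegree i = foldr-⊔-upperBound _ (∈-map⁺ (degree G) (∈-allFin i))

  maxDegree-attained : ¬ maxDegree G ≡ 0 → ∃ λ v → degree G v ≡ maxDegree G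
  maxDegree-attained Δ≢0 with foldr-selective ⊔-sel 0 (map (degree G) (allFin n))
  ... | inj₁ Δ≡0 = ⊥-elim (Δ≢0 Δ≡0)
  ... | inj₂ Δ∈  with v , _ , Δ≡dᵥ ← ∈-map⁻ (degree G) Δ∈ = v , sym Δ≡dᵥ

  OnIsolatedEdge : Fin n → Set
  OnIsolatedEdge u = degree G u ≡ 1 × (∀ k → adj G u k ≡ true → degree G k ≡ 1)

  onIsolatedEdge-step : ∀ {u k} → OnIsolatedEdge u → adj G u k ≡ true → OnIsolatedEdge k
  onIsolatedEdge-step {u} {k} (dᵤ≡1 , nbr≡1) e = dₖ≡1 , λ k′ e′ →
    subst (λ w → degree G w ≡ 1) (neighbour-unique dₖ≡1 (trans (symmetric G k u) e) e′) dᵤ≡1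
    where dₖ≡1 = nbr≡1 k e

⊗-as-∑ : ∀ {n} (B C : Fin n → Fin n → ℕ) i j → (B ⊗ C) i j ≡ ∑[ k < n ] (B i k * C k j)
⊗-as-∑ B C i j = sum-map-allFin (λ k → B i k * C k j)

factoredInto-sym : ∀ {n} {G H K : Graph n} → FactoredInto G H K → FactoredInto G K H
factoredInto-sym {n} {G} {H} {K} G=HK i j = begin
  adjMat G i j                                  ≡⟨ cong bit (symmetric G i j) ⟩
  adjMat G j i                                  ≡⟨ trans (G=HK j i) (⊗-as-∑ (adjMat H) (adjMat K) j i) ⟩
  ∑[ k < n ] (adjMat H j k * adjMat K k i)     ≡⟨ sum-cong-≗ swap ⟩
  ∑[ k < n ] (adjMat K i k * adjMat H k j)     ≡⟨ ⊗-as-∑ (adjMat K) (adjMat H) i j ⟨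
  (adjMat K ⊗ adjMat H) i j                     ∎
  where
  open ≡-Reasoning
  swap : ∀ k → adjMat H j k * adjMat K k i ≡ adjMat K i k * adjMat H k j
  swap k = trans (*-comm (adjMat H j k) (adjMat K k i)) (cong₂ (λ x y → bit x * bit y) (symmetric K k i) (symmetric H j k))

module Factorisation {n} (G H K : Graph n) (G=HK : FactoredInto G H K) where

  private
    A = adjMat G
    B = adjMat H
    C = adjMat K

  product-entry : ∀ i j → A i j ≡ ∑[ k < n ] (B i k * C k j)
  product-entry i j = trans (G=HK i j) (⊗-as-∑ B C i j)

  reversed-product-entry : ∀ i j → A i j ≡ ∑[ k < n ] (C i k * B k j)
  reversed-product-entry i j = trans (factoredInto-sym {G = G} {H} {K} G=HK i j) (⊗-as-∑ C B i j)

  edge-via-path : ∀ {i k j} → adj H i k ≡ true → adj K k j ≡ true → adj G i j ≡ true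
  edge-via-path {i} {k} {j} e e′ = bit-positive (begin-strict
    0                            <⟨ s≤s z≤n ⟩
    1                            ≡⟨ cong₂ (λ x y → bit x * bit y) e e′ ⟨
    B i k * C k j                ≤⟨ term≤∑ (λ m → B i m * C m j) k ⟩
    ∑[ m < n ] (B i m * C m j)   ≡⟨ product-entry i j ⟨
    A i j                        ∎)
    where open ≤-Reasoning

  edge-splits : ∀ {i j} → adj G i j ≡ true → ∃ λ k → adj H i k ≡ true × adj K k j ≡ true
  edge-splits {i} {j} e =
    Product.map₂ bit*bit-positive (∑-positive _ (subst (0 <_) (trans (cong bit (sym e)) (product-entry i j)) ≤-refl))

  -- Double counting: each K-neighbour j of k is a G-neighbour of i, so by G = KH some
  -- K-neighbour m of i has H-neighbour j; a fixed m serves at most A m k ≤ 1 such j.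
  degreeᴷ-mono : ∀ {i k} → adj H i k ≡ true → degree K k ≤ degree K i
  degreeᴷ-mono {i} {k} e = begin
    degree K k                                          ≡⟨ degree-as-∑ K k ⟩
    ∑[ j < n ] C k j                                    ≤⟨ ∑-mono-≤ {n} (λ j → bit≤bit*bit (edge-via-path e)) ⟩
    ∑[ j < n ] (C k j * A i j)                          ≡⟨ sum-cong-≗ {n} (λ j → cong (C k j *_) (reversed-product-entry i j)) ⟩
    ∑[ j < n ] (C k j * ∑[ m < n ] (C i m * B m j))   ≡⟨ sum-cong-≗ {n} (λ j → *-distribˡ-sum (C k j) (λ m → C i m * B m j)) ⟩
    ∑[ j < n ] ∑[ m < n ] (C k j * (C i m * B m j))     ≡⟨ ∑-comm (λ j m → C k j * (C i m * B m j)) ⟩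
    ∑[ m < n ] ∑[ j < n ] (C k j * (C i m * B m j))     ≡⟨ sum-cong-≗ {n} (λ m → sum-cong-≗ {n} (rearrange m)) ⟩
    ∑[ m < n ] ∑[ j < n ] (C i m * (B m j * C j k))     ≡⟨ sum-cong-≗ {n} (λ m → *-distribˡ-sum (C i m) (λ j → B m j * C j k)) ⟨
    ∑[ m < n ] (C i m * ∑[ j < n ] (B m j * C j k))     ≡⟨ sum-cong-≗ {n} (λ m → cong (C i m *_) (product-entry m k)) ⟨
    ∑[ m < n ] (C i m * A m k)                          ≤⟨ ∑-mono-≤ {n} (λ m → m*bit≤m (C i m) (adj G m k)) ⟩
    ∑[ m < n ] C i m                                    ≡⟨ degree-as-∑ K i ⟨
    degree K i                                          ∎
    where
    open ≤-Reasoning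
    rearrange : ∀ m j → C k j * (C i m * B m j) ≡ C i m * (B m j * C j k)
    rearrange m j = trans (cong (_* (C i m * B m j)) (cong bit (symmetric K k j)))
                          (trans (*-comm (C j k) _) (*-assoc (C i m) (B m j) (C j k)))

  degreeᴷ-const : ∀ {i k} → adj H i k ≡ true → degree K k ≡ degree K i
  degreeᴷ-const {i} {k} e = ≤-antisym (degreeᴷ-mono e) (degreeᴷ-mono (trans (symmetric H k i) e))

  degree-factor : ∀ i → degree G i ≡ degree H i * degree K i
  degree-factor i = begin
    degree G i                                    ≡⟨ degree-as-∑ G i ⟩
    ∑[ j < n ] A i j                              ≡⟨ sum-cong-≗ {n} (product-entry i) ⟩
    ∑[ j < n ] ∑[ k < n ] (B i k * C k j)         ≡⟨ ∑-comm (λ j k → B i k * C k j) ⟩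
    ∑[ k < n ] ∑[ j < n ] (B i k * C k j)         ≡⟨ sum-cong-≗ {n} (λ k → *-distribˡ-sum (B i k) (C k)) ⟨
    ∑[ k < n ] (B i k * ∑[ j < n ] C k j)         ≡⟨ sum-cong-≗ {n} (λ k → cong (B i k *_) (degree-as-∑ K k)) ⟨
    ∑[ k < n ] (B i k * degree K k)               ≡⟨ sum-cong-≗ {n} (λ k → bit*-cong (degreeᴷ-const {i} {k})) ⟩
    ∑[ k < n ] (B i k * degree K i)               ≡⟨ *-distribʳ-sum (degree K i) (B i) ⟨
    (∑[ k < n ] B i k) * degree K i               ≡⟨ cong (_* degree K i) (degree-as-∑ H i) ⟨
    degree H i * degree K i                       ∎
    where open ≡-Reasoning

module IsolatedEdgePropagation {n} (G H K : Graph n) (G=HK : FactoredInto G H K) where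

  open Factorisation G H K G=HK
  private
    module Reversed = Factorisation G K H (factoredInto-sym {G = G} {H} {K} G=HK)

  onIsolatedEdge-along-K : ∀ {k j} → OnIsolatedEdge H k → adj K k j ≡ true → OnIsolatedEdge H j
  onIsolatedEdge-along-K (dₖ≡1 , nbr≡1) e = trans (Reversed.degreeᴷ-const e) dₖ≡1 , λ m e′ →
    let x , eₕ , eₖ = edge-splits (Reversed.edge-via-path e e′)
    in trans (Reversed.degreeᴷ-const eₖ) (nbr≡1 x eₕ)

  onIsolatedEdge-along-G : ∀ {u j} → OnIsolatedEdge H u → adj G u j ≡ true → OnIsolatedEdge H j
  onIsolatedEdge-along-G u-iso e =
    let k , eₕ , eₖ = edge-splits e
    in onIsolatedEdge-along-K (onIsolatedEdge-step H u-iso eₕ) eₖ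

  onIsolatedEdge-along-walk : ∀ {u j} → Walk G u j → OnIsolatedEdge H u → OnIsolatedEdge H j
  onIsolatedEdge-along-walk here         u-iso = u-iso
  onIsolatedEdge-along-walk (step e walk) u-iso = onIsolatedEdge-along-walk walk (onIsolatedEdge-along-G u-iso e)

  onIsolatedEdge-at-max : ∀ {v} → (∀ i → degree G i ≤ degree G v) → degree H v ≡ 1 → OnIsolatedEdge H v
  onIsolatedEdge-at-max {v} v-max dᵥ≡1 = dᵥ≡1 , λ k e →
    ≤-antisym (dₖ≤1 k e) (degree-positive H k)
    where
    dₖ≤1 : ∀ k → adj H v k ≡ true → degree H k ≤ 1
    dₖ≤1 k e = *-cancelʳ-≤ (degree H k) 1 (degree K k) {{>-nonZero (degree-positive K k)}} (begin
      degree H k * degree K k      ≡⟨ degree-factor k ⟨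
      degree G k                   ≤⟨ v-max k ⟩
      degree G v                   ≡⟨ degree-factor v ⟩
      degree H v * degree K v      ≡⟨ cong₂ _*_ dᵥ≡1 (sym (degreeᴷ-const e)) ⟩
      1 * degree K k               ∎)
      where open ≤-Reasoning

  perfectMatching-from-max : ∀ {v} → Connected G → (∀ i → degree G i ≤ degree G v) →
                             degree H v ≡ 1 → PerfectMatching H
  perfectMatching-from-max {v} connected v-max dᵥ≡1 i =
    proj₁ (onIsolatedEdge-along-walk (connected v i) (onIsolatedEdge-at-max v-max dᵥ≡1))

mainTheorem15 : ∀ {n : ℕ} (G : Graph n) → Connected G → Prime (maxDegree G) →
    IsPrimeGraph G
mainTheorem15 G connected Δ-prime H K G=HK
  with v , dᵥ≡Δ ← maxDegree-attained G (≢-nonZero⁻¹ _ {{prime⇒nonZero Δ-prime}})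
  = Sum.map (HK.perfectMatching-from-max connected v-max) (KH.perfectMatching-from-max connected v-max)
            (prime[m*n]⇒m≡1⊎n≡1 (subst Prime dᵥ≡HK Δ-prime))
  where
  G=KH : FactoredInto G K H
  G=KH = factoredInto-sym {G = G} {H} {K} G=HK
  module HK = IsolatedEdgePropagation G H K G=HK
  module KH = IsolatedEdgePropagation G K H G=KH
  v-max : ∀ i → degree G i ≤ degree G v
  v-max i = subst (degree G i ≤_) (sym dᵥ≡Δ) (degree≤maxDegree G i)
  dᵥ≡HK : maxDegree G ≡ degree H v * degree K v
  dᵥ≡HK = trans (sym dᵥ≡Δ) (Factorisation.degree-factor G H K G=HK v)
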